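{- Let $R\subseteq[n]^2$ with $|R|\le Cn$, and suppose that with probability at least $\gamma>0$ a uniformly random $\pi\in S_n$ avoids $R$, i.e. $(i,\pi(i))\notin R$ for all $i\in[n]$. If $n\ge 8C/\gamma+2$, then for all $i,j\in[n]$, $\Pr_{\pi\in S_n}[\pi\text{ avoids }R\setminus\{(i,j)\}\mid\pi(i)=j]\ge\gamma/2$. If $n\ge32C/\gamma+3$, then for all $i_1,j_1,i_2,j_2\in[n]$ with $i_1\neq i_2$ and $j_1\neq j_2$, $\Pr_{\pi\in S_n}[\pi\text{ avoids }R\setminus\{(i_1,j_1),(i_2,j_2)\}\mid\pi(i_1)=j_1\text{ and }\pi(i_2)=j_2]\ge\gamma/4$.
   Context: $S_n$ is the symmetric group on $[n]=\{1,\dots,n\}$, $C>0$.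
   Formalization: The constants C and γ are taken to be positive rationals. -}

module Defs where

open import Data.Nat using (ℕ; zero; suc)
open import Data.Bool using (Bool; true; false; not; _∧_; _∨_; if_then_else_)
open import Data.Fin using (Fin; _≟_)
open import Data.Vec using (Vec; []; _∷_; lookup)
open import Data.List using (List; []; _∷_; concatMap; map; filterᵇ; length; allFin; foldr; cartesianProduct)
open import Data.Product using (_×_; _,_; proj₁; proj₂)
open import Data.Integer using (+_)
open import Data.Rational using (ℚ; 0ℚ; _/_)
open import Relation.Nullary.Decidable using (⌊_⌋)

allB : ∀ {A : Set} → (A → Bool) → List A → Bool
allB p = foldr (λ x b → p x ∧ b) true

-- [n] is modelled as Fin n.  A map [n] → [n] is a vector of length n over Fin n.
allVecs : (m k : ℕ) → List (Vec (Fin k) m)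
allVecs zero    k = [] ∷ []
allVecs (suc m) k = concatMap (λ x → map (x ∷_) (allVecs m k)) (allFin k)

isPerm : ∀ {n} → Vec (Fin n) n → Bool
isPerm {n} v = allB (λ i → allB (λ j → not ⌊ lookup v i ≟ lookup v j ⌋ ∨ ⌊ i ≟ j ⌋) (allFin n)) (allFin n)

Sym : (n : ℕ) → List (Vec (Fin n) n)
Sym n = filterᵇ isPerm (allVecs n n)

Rel2 : ℕ → Set
Rel2 n = Fin n → Fin n → Bool

card : ∀ {n} → Rel2 n → ℕ
card {n} R = length (filterᵇ (λ p → R (proj₁ p) (proj₂ p)) (cartesianProduct (allFin n) (allFin n)))

avoids : ∀ {n} → Rel2 n → Vec (Fin n) n → Bool
avoids {n} R π = allB (λ i → not (R i (lookup π i))) (allFin n)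

remove : ∀ {n} → Rel2 n → Fin n → Fin n → Rel2 n
remove R i j a b = R a b ∧ not (⌊ a ≟ i ⌋ ∧ ⌊ b ≟ j ⌋)

maps : ∀ {n} → Fin n → Fin n → Vec (Fin n) n → Bool
maps i j π = ⌊ lookup π i ≟ j ⌋

count : ∀ {n} → (Vec (Fin n) n → Bool) → ℕ
count {n} P = length (filterᵇ P (Sym n))

ratio : ℕ → ℕ → ℚ
ratio a zero    = 0ℚ
ratio a (suc b) = (+ a) / suc b

Pr : ∀ {n} → (Vec (Fin n) n → Bool) → ℚ
Pr {n} A = ratio (count A) (count {n} (λ _ → true))

-- Pr_{π ∈ S_n}[A | B] = |A ∩ B| / |B|  (0 if B is empty; never used that way here)
PrCond : ∀ {n} → (Vec (Fin n) n → Bool) → (Vec (Fin n) n → Bool) → ℚ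
PrCond A B = ratio (count (λ π → A π ∧ B π)) (count B)

ℕ→ℚ : ℕ → ℚ
ℕ→ℚ k = (+ k) / 1

{-# OPTIONS --safe #-}
module Submission where

-- Let Q be a condition on permutations preserved by exchanging two values outside a small
-- forbidden set F, and let M be the event π(i) = j.  Composition with transpositions of values
-- yields three injections:
--   (a , π) ↦ (j a) ∘ π, for a ∉ F, shows  (n − |F|) · #(Q ∧ M) ≤ #Q;
--   π ↦ (π(i) , (π(i) j) ∘ π) sends an R-avoiding permutation in Q to one in Q ∧ M avoiding
--   R ∖ {(i , j)}, unless π is blocked: (k , π(i)) ∈ R for the position k ≠ i of the value j;
--   (a , π) ↦ ((k , π(i)) , (π(i) a)(π(i) j) ∘ π), for a ∉ F ∪ {j}, shows that there are at
--   most |R| · #(Q ∧ M) / (n − |F| − 1) blocked ones.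
-- With |R| ≤ Cn and n large compared with C over the current probability bound, the conditional
-- probability of avoiding R ∖ {(i , j)} given Q ∧ M is then at least half that of avoiding R
-- given Q.  The first claim is one such step with Q trivial, the second a further step with Q
-- the event π(i₁) = j₁ and F = {j₁}.

open import Defs
open import Data.Nat using (ℕ)
open import Data.Fin using (Fin)
open import Data.Bool using (_∧_)
open import Data.Product using (_×_)
open import Relation.Binary.PropositionalEquality using (_≢_)
open import Data.Rational using (ℚ; 0ℚ; _≤_; _<_; _+_; _*_; _÷_; _/_; >-nonZero)

open import Data.Nat as ℕ using (zero; suc; z≤n; s≤s; _∸_)
import Data.Nat.Properties as ℕ
import Data.Nat.Solver as ℕ-Solver
open import Data.Integer as ℤ using (+_)
import Data.Integer.Properties as ℤ
open import Data.Rational as ℚ using (1/_; -_; toℚᵘ)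
import Data.Rational.Properties as ℚ
open import Data.Rational.Unnormalised as ℚᵘ using (mkℚᵘ; *≡*; *≤*)
import Data.Rational.Unnormalised.Properties as ℚᵘ
import Data.Rational.Solver as ℚ-Solver
open import Data.Fin using (_≟_)
open import Data.Fin.Properties using (any?; nonZeroIndex)
open import Data.Fin.Permutation.Components using (transpose; transpose-inverse)
open import Data.Bool using (Bool; true; false; not; _∨_; T; T?)
open import Data.Bool.Properties using (T-∧; T-≡; T-not-≡; ∧-zeroʳ)
open import Data.Vec as Vec using (Vec; []; _∷_; lookup)
import Data.Vec.Properties as Vec
open import Data.List using (List; []; _∷_; filter; _++_; map; filterᵇ; length; allFin; cartesianProduct)
open import Data.List.Properties using (length-++; length-map; length-++-sucʳ; length-tabulate)
open import Data.List.Membership.Propositional using (_∈_; _∉_)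
open import Data.List.Membership.Propositional.Properties
  using (∈-∃++; ∈-++⁻; ∈-++⁺ˡ; ∈-++⁺ʳ; ∈-filter⁻; ∈-filter⁺; ∈-allFin; ∈-map⁺; ∈-map⁻; ∈-concat⁺′;
         ∈-cartesianProduct⁺; ∈-cartesianProduct⁻)
open import Data.List.Relation.Unary.Any using (here; there)
open import Data.List.Relation.Unary.All as All using (All; []; _∷_)
import Data.List.Relation.Unary.All.Properties as All
import Data.List.Relation.Unary.AllPairs as AllPairs
import Data.List.Relation.Unary.AllPairs.Properties as AllPairs
open import Data.List.Relation.Unary.AllPairs using ([]; _∷_)
open import Data.List.Relation.Unary.Unique.Propositional using (Unique)
open import Data.List.Relation.Binary.Disjoint.Propositional using (Disjoint)
import Data.List.Relation.Unary.Unique.Propositional.Properties as Unique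
open import Data.Product using (_,_; proj₁; proj₂; map₂; ∃-syntax)
open import Data.Sum using (inj₁; inj₂)
open import Function using (_∘_; _⇔_; mk⇔; Equivalence; id)
open import Relation.Nullary using (Dec; yes; no; contradiction)
open import Relation.Nullary.Decidable using (⌊_⌋; dec-true; dec-false; toWitness; fromWitness; toWitnessFalse)
open import Relation.Binary.PropositionalEquality
  using (_≡_; refl; sym; trans; cong; cong₂; subst; subst₂; module ≡-Reasoning)

open Equivalence using (to; from)

private
  variable
    A B : Set

length-cartesianProduct : (xs : List A) (ys : List B) →
  length (cartesianProduct xs ys) ≡ length xs ℕ.* length ys
length-cartesianProduct []       ys = refl
length-cartesianProduct (x ∷ xs) ys = trans (length-++ (map (x ,_) ys))
  (cong₂ ℕ._+_ (length-map (x ,_) ys) (length-cartesianProduct xs ys))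

length-filterᵇ-mono : {p q : A → Bool} → (∀ x → T (p x) → T (q x)) → (xs : List A) →
  length (filterᵇ p xs) ℕ.≤ length (filterᵇ q xs)
length-filterᵇ-mono p⇒q [] = z≤n
length-filterᵇ-mono {p = p} {q} p⇒q (x ∷ xs) with p x in px | q x in qx
... | true  | true  = s≤s (length-filterᵇ-mono p⇒q xs)
... | true  | false with () ← trans (sym qx) (to T-≡ (p⇒q x (from T-≡ px)))
... | false | true  = ℕ.m≤n⇒m≤1+n (length-filterᵇ-mono p⇒q xs)
... | false | false = length-filterᵇ-mono p⇒q xs

length-filterᵇ-split : (p b : A → Bool) (xs : List A) →
  length (filterᵇ p xs) ≡ length (filterᵇ (λ x → p x ∧ not (b x)) xs) ℕ.+ length (filterᵇ (λ x → p x ∧ b x) xs)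
length-filterᵇ-split p b [] = refl
length-filterᵇ-split p b (x ∷ xs) with p x | b x
... | true  | true  = trans (cong suc (length-filterᵇ-split p b xs)) (sym (ℕ.+-suc _ _))
... | true  | false = cong suc (length-filterᵇ-split p b xs)
... | false | _     = length-filterᵇ-split p b xs

length-≤-injection : (f : A → B) {xs : List A} {ys : List B} → Unique xs →
  (∀ {x} → x ∈ xs → f x ∈ ys) →
  (∀ {x y} → x ∈ xs → y ∈ xs → f x ≡ f y → x ≡ y) →
  length xs ℕ.≤ length ys
length-≤-injection f {[]} _ _ _ = z≤n
length-≤-injection f {x ∷ xs} {ys} (x∉xs ∷ unique) into inj
  with us , vs , refl ← ∈-∃++ (into (here refl)) = begin
    suc (length xs)          ≤⟨ s≤s (length-≤-injection f unique into′ (λ y z → inj (there y) (there z))) ⟩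
    suc (length (us ++ vs))  ≡⟨ length-++-sucʳ us (f x) vs ⟨
    length (us ++ f x ∷ vs)  ∎
  where
  open ℕ.≤-Reasoning
  into′ : ∀ {y} → y ∈ xs → f y ∈ us ++ vs
  into′ {y} y∈xs with ∈-++⁻ us (into (there y∈xs))
  ... | inj₁ fy∈us         = ∈-++⁺ˡ fy∈us
  ... | inj₂ (there fy∈vs) = ∈-++⁺ʳ us fy∈vs
  ... | inj₂ (here fy≡fx)  = contradiction (inj (here refl) (there y∈xs) (sym fy≡fx)) (All.lookup x∉xs y∈xs)

T-allB : {p : A → Bool} {xs : List A} → T (allB p xs) ⇔ All (T ∘ p) xs
T-allB {xs = []}     = mk⇔ (λ _ → []) (λ _ → _)
T-allB {xs = x ∷ xs} = mk⇔
  (λ t → let px , rest = to T-∧ t in px ∷ to T-allB rest)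
  (λ { (px ∷ rest) → from T-∧ (px , from T-allB rest) })

T-allB-allFin : ∀ {n} {p : Fin n → Bool} → T (allB p (allFin n)) ⇔ (∀ x → T (p x))
T-allB-allFin {n} = mk⇔ (λ t x → All.lookup (to (T-allB {xs = allFin n}) t) (∈-allFin x))
                        (λ h → from (T-allB {xs = allFin n}) (All.tabulate (λ {x} _ → h x)))

-- Permutations of [n] and their enumeration

SelfMap : ℕ → Set
SelfMap n = Vec (Fin n) n

IsInjective : ∀ {n} → SelfMap n → Set
IsInjective π = ∀ x y → lookup π x ≡ lookup π y → x ≡ y

∈-allVecs : ∀ {m k} (v : Vec (Fin k) m) → v ∈ allVecs m k
∈-allVecs []      = here refl
∈-allVecs {suc m} {k} (x ∷ v) =
  ∈-concat⁺′ (∈-map⁺ (x ∷_) (∈-allVecs v)) (∈-map⁺ (λ y → map (y ∷_) (allVecs m k)) (∈-allFin x))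

allVecs-unique : ∀ m k → Unique (allVecs m k)
allVecs-unique zero    k = [] ∷ []
allVecs-unique (suc m) k = Unique.concat⁺
  (All.map⁺ (All.tabulate (λ _ → Unique.map⁺ (proj₂ ∘ Vec.∷-injective) (allVecs-unique m k))))
  (AllPairs.map⁺ (AllPairs.map disjoint (Unique.allFin⁺ k)))
  where
  disjoint : ∀ {x y : Fin k} → x ≢ y → Disjoint
               (map (x ∷_) (allVecs m k)) (map (y ∷_) (allVecs m k))
  disjoint x≢y (u , w) with ∈-map⁻ _ u | ∈-map⁻ _ w
  ... | _ , _ , refl | _ , _ , eq = x≢y (proj₁ (Vec.∷-injective eq))

T-⌊≟⌋⇒⌊≟⌋ : ∀ {m k} {a b : Fin m} {x y : Fin k} →
  T (not ⌊ a ≟ b ⌋ ∨ ⌊ x ≟ y ⌋) ⇔ (a ≡ b → x ≡ y)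
T-⌊≟⌋⇒⌊≟⌋ {a = a} {b} {x} {y} with a ≟ b | x ≟ y
... | yes _   | yes x≡y = mk⇔ (λ _ _ → x≡y) _
... | yes a≡b | no x≢y  = mk⇔ (λ ()) (λ h → x≢y (h a≡b))
... | no a≢b  | _       = mk⇔ (λ _ a≡b → contradiction a≡b a≢b) _

T-isPerm : ∀ {n} {π : SelfMap n} → T (isPerm π) ⇔ IsInjective π
T-isPerm = mk⇔
  (λ t x y → to T-⌊≟⌋⇒⌊≟⌋ (to T-allB-allFin (to T-allB-allFin t x) y))
  (λ inj → from T-allB-allFin λ x → from T-allB-allFin λ y → from T-⌊≟⌋⇒⌊≟⌋ (inj x y))

∈-Sym : ∀ {n} {π : SelfMap n} → π ∈ Sym n ⇔ IsInjective π
∈-Sym {n} {π} = mk⇔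
  (λ π∈ → to (T-isPerm {π = π}) (proj₂ (∈-filter⁻ (T? ∘ isPerm) {xs = allVecs n n} π∈)))
  (λ inj → ∈-filter⁺ (T? ∘ isPerm) (∈-allVecs π) (from (T-isPerm {π = π}) inj))

SymWhere : ∀ n → (SelfMap n → Bool) → List (SelfMap n)
SymWhere n P = filterᵇ P (Sym n)

∈-SymWhere : ∀ {n P} {π : SelfMap n} → π ∈ SymWhere n P ⇔ (IsInjective π × T (P π))
∈-SymWhere {n} {P} = mk⇔
  (λ π∈ → let π∈Sym , Pπ = ∈-filter⁻ (T? ∘ P) {xs = Sym n} π∈ in to ∈-Sym π∈Sym , Pπ)
  (λ (inj , Pπ) → ∈-filter⁺ (T? ∘ P) (from ∈-Sym inj) Pπ)

SymWhere-unique : ∀ n P → Unique (SymWhere n P)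
SymWhere-unique n P = Unique.filter⁺ (T? ∘ P) (Unique.filter⁺ (T? ∘ isPerm) (allVecs-unique n n))

-- Transpositions of values

module _ {n : ℕ} where

  transpose-ˡ : (a b : Fin n) → transpose a b a ≡ b
  transpose-ˡ a b rewrite dec-true (a ≟ a) refl = refl

  transpose-ʳ : (a b : Fin n) → transpose a b b ≡ a
  transpose-ʳ a b with b ≟ a
  ... | yes b≡a = b≡a
  ... | no _ rewrite dec-true (b ≟ b) refl = refl

  transpose-fixes : {a b x : Fin n} → x ≢ a → x ≢ b → transpose a b x ≡ x
  transpose-fixes {a} {b} {x} x≢a x≢b rewrite dec-false (x ≟ a) x≢a | dec-false (x ≟ b) x≢b = refl

  transpose-injective : (a b : Fin n) {x y : Fin n} → transpose a b x ≡ transpose a b y → x ≡ y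
  transpose-injective a b {x} {y} eq = begin
    x                             ≡⟨ transpose-inverse b a ⟨
    transpose b a (transpose a b x) ≡⟨ cong (transpose b a) eq ⟩
    transpose b a (transpose a b y) ≡⟨ transpose-inverse b a ⟩
    y                             ∎
    where open ≡-Reasoning

  swap : Fin n → Fin n → SelfMap n → SelfMap n
  swap a b = Vec.map (transpose a b)

  lookup-swap : (a b : Fin n) (π : SelfMap n) (x : Fin n) → lookup (swap a b π) x ≡ transpose a b (lookup π x)
  lookup-swap a b π x = Vec.lookup-map x (transpose a b) π

  swap-injective : (a b : Fin n) (π : SelfMap n) → IsInjective π → IsInjective (swap a b π)
  swap-injective a b π inj x y eq = inj x y (transpose-injective a b (begin
    transpose a b (lookup π x) ≡⟨ lookup-swap a b π x ⟨
    lookup (swap a b π) x      ≡⟨ eq ⟩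
    lookup (swap a b π) y      ≡⟨ lookup-swap a b π y ⟩
    transpose a b (lookup π y) ∎))
    where open ≡-Reasoning

  swap-swap : (a b : Fin n) (π : SelfMap n) → swap b a (swap a b π) ≡ π
  swap-swap a b π = begin
    swap b a (swap a b π)                  ≡⟨ Vec.map-∘ (transpose b a) (transpose a b) π ⟨
    Vec.map (transpose b a ∘ transpose a b) π ≡⟨ Vec.map-cong (λ _ → transpose-inverse b a) π ⟩
    Vec.map id π                           ≡⟨ Vec.map-id π ⟩
    π                                      ∎
    where open ≡-Reasoning

  swap-cancel : (a b : Fin n) {π ρ : SelfMap n} → swap a b π ≡ swap a b ρ → π ≡ ρ
  swap-cancel a b {π} {ρ} eq = begin
    π                     ≡⟨ swap-swap a b π ⟨
    swap b a (swap a b π) ≡⟨ cong (swap b a) eq ⟩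
    swap b a (swap a b ρ) ≡⟨ swap-swap a b ρ ⟩
    ρ                     ∎
    where open ≡-Reasoning

module _ {n : ℕ} where
  open import Data.List.Membership.DecPropositional (_≟_ {n}) using (_∉?_; _∈?_)

  free : List (Fin n) → List (Fin n)
  free Fs = filter (_∉? Fs) (allFin n)

  ∈-free : ∀ {Fs a} → a ∈ free Fs → a ∉ Fs
  ∈-free {Fs} a∈ = proj₂ (∈-filter⁻ (_∉? Fs) {xs = allFin n} a∈)

  free-unique : ∀ Fs → Unique (free Fs)
  free-unique Fs = Unique.filter⁺ (_∉? Fs) (Unique.allFin⁺ n)

  length-free : ∀ Fs → n ℕ.≤ length (free Fs) ℕ.+ length Fs
  length-free Fs = begin
    n                               ≡⟨ length-tabulate id ⟨
    length (allFin n)               ≤⟨ length-≤-injection id (Unique.allFin⁺ n) into (λ _ _ → id) ⟩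
    length (free Fs ++ Fs)          ≡⟨ length-++ (free Fs) ⟩
    length (free Fs) ℕ.+ length Fs  ∎
    where
    open ℕ.≤-Reasoning
    into : ∀ {a} → a ∈ allFin n → a ∈ free Fs ++ Fs
    into {a} a∈ with a ∈? Fs
    ... | yes a∈Fs = ∈-++⁺ʳ (free Fs) a∈Fs
    ... | no a∉Fs  = ∈-++⁺ˡ (∈-filter⁺ (_∉? Fs) a∈ a∉Fs)

module _ {n : ℕ} where

  T-avoids : (R : Rel2 n) (π : SelfMap n) → T (avoids R π) ⇔ (∀ x → R x (lookup π x) ≡ false)
  T-avoids R π = mk⇔ (λ t x → to T-not-≡ (to T-allB-allFin t x))
                 (λ h → from T-allB-allFin (λ x → from T-not-≡ (h x)))

  T-maps : (i j : Fin n) (π : SelfMap n) → T (maps i j π) ⇔ lookup π i ≡ j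
  T-maps i j π = mk⇔ toWitness fromWitness

  remove-removed : (R : Rel2 n) (i j : Fin n) → remove R i j i j ≡ false
  remove-removed R i j with i ≟ i | j ≟ j
  ... | yes _  | yes _  = ∧-zeroʳ (R i j)
  ... | no i≢i | _      = contradiction refl i≢i
  ... | yes _  | no j≢j = contradiction refl j≢j

  remove-false : (R : Rel2 n) (i j : Fin n) {a b : Fin n} → R a b ≡ false → remove R i j a b ≡ false
  remove-false R i j Rab rewrite Rab = refl

  card-remove : (R : Rel2 n) (i j : Fin n) → card (remove R i j) ℕ.≤ card R
  card-remove R i j = length-filterᵇ-mono (λ (a , b) → proj₁ ∘ to T-∧) (cartesianProduct (allFin n) (allFin n))

-- One conditioning step

-- Chaining the first four hypotheses gives p D d b ≤ q n d a + q r b, and the threshold absorbs q r b.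
conditioning-arith : ∀ {p q n D d r N α a β b} .{{_ : ℕ.NonZero (n ℕ.* d)}} →
  D ℕ.* b ℕ.≤ N → p ℕ.* N ℕ.≤ q ℕ.* α → α ℕ.≤ n ℕ.* a ℕ.+ β → d ℕ.* β ℕ.≤ r ℕ.* b →
  2 ℕ.* q ℕ.* r ℕ.+ p ℕ.* d ℕ.* n ℕ.≤ 2 ℕ.* p ℕ.* d ℕ.* D → p ℕ.* b ℕ.≤ 2 ℕ.* q ℕ.* a
conditioning-arith {p} {q} {n} {D} {d} {r} {N} {α} {a} {β} {b} Db≤N pN≤qα α≤na+β dβ≤rb threshold =
  ℕ.*-cancelˡ-≤ (n ℕ.* d) (ℕ.+-cancelʳ-≤ (2 ℕ.* q ℕ.* r ℕ.* b) _ _ (begin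
    n ℕ.* d ℕ.* (p ℕ.* b) ℕ.+ 2 ℕ.* q ℕ.* r ℕ.* b            ≡⟨ solve 6 (λ p q n d r b → n :* d :* (p :* b) :+ con 2 :* q :* r :* b
                                                                  := (con 2 :* q :* r :+ p :* d :* n) :* b) refl p q n d r b ⟩
    (2 ℕ.* q ℕ.* r ℕ.+ p ℕ.* d ℕ.* n) ℕ.* b                  ≤⟨ ℕ.*-monoˡ-≤ b threshold ⟩
    2 ℕ.* p ℕ.* d ℕ.* D ℕ.* b                                ≡⟨ solve 4 (λ p d D b → con 2 :* p :* d :* D :* b := con 2 :* d :* (p :* (D :* b))) refl p d D b ⟩
    2 ℕ.* d ℕ.* (p ℕ.* (D ℕ.* b))                            ≤⟨ ℕ.*-monoʳ-≤ (2 ℕ.* d) pDb≤q[na+β] ⟩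
    2 ℕ.* d ℕ.* (q ℕ.* (n ℕ.* a ℕ.+ β))                      ≡⟨ solve 5 (λ d q n a β → con 2 :* d :* (q :* (n :* a :+ β))
                                                                  := n :* d :* (con 2 :* q :* a) :+ con 2 :* q :* (d :* β)) refl d q n a β ⟩
    n ℕ.* d ℕ.* (2 ℕ.* q ℕ.* a) ℕ.+ 2 ℕ.* q ℕ.* (d ℕ.* β)    ≤⟨ ℕ.+-monoʳ-≤ (n ℕ.* d ℕ.* (2 ℕ.* q ℕ.* a)) (ℕ.*-monoʳ-≤ (2 ℕ.* q) dβ≤rb) ⟩
    n ℕ.* d ℕ.* (2 ℕ.* q ℕ.* a) ℕ.+ 2 ℕ.* q ℕ.* (r ℕ.* b)    ≡⟨ cong (n ℕ.* d ℕ.* (2 ℕ.* q ℕ.* a) ℕ.+_) (ℕ.*-assoc (2 ℕ.* q) r b) ⟨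
    n ℕ.* d ℕ.* (2 ℕ.* q ℕ.* a) ℕ.+ 2 ℕ.* q ℕ.* r ℕ.* b      ∎))
  where
  open ℕ.≤-Reasoning
  open ℕ-Solver.+-*-Solver
  pDb≤q[na+β] : p ℕ.* (D ℕ.* b) ℕ.≤ q ℕ.* (n ℕ.* a ℕ.+ β)
  pDb≤q[na+β] = ℕ.≤-trans (ℕ.*-monoʳ-≤ p Db≤N) (ℕ.≤-trans pN≤qα (ℕ.*-monoʳ-≤ q α≤na+β))

conditioning-pos : ∀ {n d r α a β b} .{{_ : ℕ.NonZero d}} →
  0 ℕ.< α → α ℕ.≤ n ℕ.* a ℕ.+ β → d ℕ.* β ℕ.≤ r ℕ.* b → a ℕ.≤ b → 0 ℕ.< b
conditioning-pos {b = suc _} _ _ _ _ = ℕ.z<s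
conditioning-pos {n} {d} {r} {α} {a} {β} {zero} 0<α α≤na+β dβ≤r*0 a≤0
  with refl ← ℕ.n≤0⇒n≡0 a≤0
     | refl ← ℕ.n≤0⇒n≡0 (ℕ.≤-trans (ℕ.m≤n*m β d) (subst (d ℕ.* β ℕ.≤_) (ℕ.*-zeroʳ r) dβ≤r*0))
  = ℕ.<-≤-trans 0<α (subst (α ℕ.≤_) (cong (ℕ._+ 0) (ℕ.*-zeroʳ n)) α≤na+β)

threshold-first : ∀ {N r α m n D d} → n ≡ 2 ℕ.+ m → 8 ℕ.* N ℕ.* r ℕ.≤ m ℕ.* n ℕ.* α →
  n ℕ.≤ D ℕ.+ 0 → n ℕ.≤ d ℕ.+ 1 → 2 ℕ.* N ℕ.* r ℕ.+ α ℕ.* d ℕ.* n ℕ.≤ 2 ℕ.* α ℕ.* d ℕ.* D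
threshold-first {N} {r} {α} {m} {n} {D} {d} refl 8Nr≤mnα n≤D n≤d+1 = begin
  2 ℕ.* N ℕ.* r ℕ.+ α ℕ.* d ℕ.* n  ≤⟨ ℕ.+-monoˡ-≤ (α ℕ.* d ℕ.* n) 2Nr≤αdn ⟩
  α ℕ.* d ℕ.* n ℕ.+ α ℕ.* d ℕ.* n  ≡⟨ solve 3 (λ α d n → α :* d :* n :+ α :* d :* n := con 2 :* α :* d :* n) refl α d n ⟩
  2 ℕ.* α ℕ.* d ℕ.* n              ≤⟨ ℕ.*-monoʳ-≤ (2 ℕ.* α ℕ.* d) (subst (n ℕ.≤_) (ℕ.+-identityʳ D) n≤D) ⟩
  2 ℕ.* α ℕ.* d ℕ.* D              ∎
  where
  open ℕ.≤-Reasoning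
  open ℕ-Solver.+-*-Solver
  m≤d : m ℕ.≤ d
  m≤d = ℕ.<⇒≤ (ℕ.+-cancelʳ-≤ 1 (suc m) d (subst (ℕ._≤ d ℕ.+ 1) (solve 1 (λ m → con 2 :+ m := con 1 :+ m :+ con 1) refl m) n≤d+1))
  2Nr≤αdn : 2 ℕ.* N ℕ.* r ℕ.≤ α ℕ.* d ℕ.* n
  2Nr≤αdn = ℕ.*-cancelˡ-≤ 4 (begin
    4 ℕ.* (2 ℕ.* N ℕ.* r)      ≡⟨ solve 2 (λ N r → con 4 :* (con 2 :* N :* r) := con 8 :* N :* r) refl N r ⟩
    8 ℕ.* N ℕ.* r              ≤⟨ 8Nr≤mnα ⟩
    m ℕ.* n ℕ.* α              ≤⟨ ℕ.*-monoˡ-≤ α (ℕ.*-monoˡ-≤ n m≤d) ⟩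
    d ℕ.* n ℕ.* α              ≡⟨ solve 3 (λ α d n → d :* n :* α := α :* d :* n) refl α d n ⟩
    α ℕ.* d ℕ.* n              ≤⟨ ℕ.m≤n*m (α ℕ.* d ℕ.* n) 4 ⟩
    4 ℕ.* (α ℕ.* d ℕ.* n)      ∎)

threshold-second : ∀ {N r r′ α m n D d} → n ≡ 3 ℕ.+ m → 32 ℕ.* N ℕ.* r ℕ.≤ m ℕ.* n ℕ.* α →
  n ℕ.≤ D ℕ.+ 1 → n ℕ.≤ d ℕ.+ 2 → r′ ℕ.≤ r →
  2 ℕ.* (2 ℕ.* N) ℕ.* r′ ℕ.+ α ℕ.* d ℕ.* n ℕ.≤ 2 ℕ.* α ℕ.* d ℕ.* D
threshold-second {N} {r} {r′} {α} {m} {n} {D} {d} refl 32Nr≤mnα n≤D+1 n≤d+2 r′≤r = begin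
  2 ℕ.* (2 ℕ.* N) ℕ.* r′ ℕ.+ α ℕ.* d ℕ.* n        ≤⟨ ℕ.+-monoˡ-≤ (α ℕ.* d ℕ.* n) 4Nr′≤αd[m+1] ⟩
  α ℕ.* d ℕ.* (m ℕ.+ 1) ℕ.+ α ℕ.* d ℕ.* (3 ℕ.+ m) ≡⟨ solve 3 (λ α d m → α :* d :* (m :+ con 1) :+ α :* d :* (con 3 :+ m)
                                                                := con 2 :* α :* d :* (m :+ con 2)) refl α d m ⟩
  2 ℕ.* α ℕ.* d ℕ.* (m ℕ.+ 2)                     ≤⟨ ℕ.*-monoʳ-≤ (2 ℕ.* α ℕ.* d) m+2≤D ⟩
  2 ℕ.* α ℕ.* d ℕ.* D                              ∎
  where
  open ℕ.≤-Reasoning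
  open ℕ-Solver.+-*-Solver
  m+2≤D : m ℕ.+ 2 ℕ.≤ D
  m+2≤D = ℕ.+-cancelʳ-≤ 1 (m ℕ.+ 2) D (subst (ℕ._≤ D ℕ.+ 1) (solve 1 (λ m → con 3 :+ m := m :+ con 2 :+ con 1) refl m) n≤D+1)
  m+1≤d : m ℕ.+ 1 ℕ.≤ d
  m+1≤d = ℕ.+-cancelʳ-≤ 2 (m ℕ.+ 1) d (subst (ℕ._≤ d ℕ.+ 2) (solve 1 (λ m → con 3 :+ m := m :+ con 1 :+ con 2) refl m) n≤d+2)
  4Nr′≤αd[m+1] : 2 ℕ.* (2 ℕ.* N) ℕ.* r′ ℕ.≤ α ℕ.* d ℕ.* (m ℕ.+ 1)
  4Nr′≤αd[m+1] = ℕ.*-cancelˡ-≤ 8 (begin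
    8 ℕ.* (2 ℕ.* (2 ℕ.* N) ℕ.* r′)                ≤⟨ ℕ.*-monoʳ-≤ 8 (ℕ.*-monoʳ-≤ (2 ℕ.* (2 ℕ.* N)) r′≤r) ⟩
    8 ℕ.* (2 ℕ.* (2 ℕ.* N) ℕ.* r)                 ≡⟨ solve 2 (λ N r → con 8 :* (con 2 :* (con 2 :* N) :* r) := con 32 :* N :* r) refl N r ⟩
    32 ℕ.* N ℕ.* r                                ≤⟨ 32Nr≤mnα ⟩
    m ℕ.* (3 ℕ.+ m) ℕ.* α                         ≤⟨ ℕ.*-monoˡ-≤ α (ℕ.m≤m+n (m ℕ.* (3 ℕ.+ m)) _) ⟩
    (m ℕ.* (3 ℕ.+ m) ℕ.+ (7 ℕ.* m ℕ.* m ℕ.+ 13 ℕ.* m ℕ.+ 8)) ℕ.* α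
                                                  ≡⟨ solve 2 (λ m α → (m :* (con 3 :+ m) :+ (con 7 :* m :* m :+ con 13 :* m :+ con 8)) :* α
                                                                      := con 8 :* (α :* (m :+ con 1) :* (m :+ con 1))) refl m α ⟩
    8 ℕ.* (α ℕ.* (m ℕ.+ 1) ℕ.* (m ℕ.+ 1))         ≤⟨ ℕ.*-monoʳ-≤ 8 (ℕ.*-monoˡ-≤ (m ℕ.+ 1) (ℕ.*-monoʳ-≤ α m+1≤d)) ⟩
    8 ℕ.* (α ℕ.* d ℕ.* (m ℕ.+ 1))                 ∎)

module Conditioning {n : ℕ} (R : Rel2 n) (Q : SelfMap n → Bool) (Fs : List (Fin n)) (i j : Fin n)
  (j∉Fs : j ∉ Fs)
  (Q-swap : ∀ x y π → x ∉ Fs → y ∉ Fs → T (Q π) → T (Q (swap x y π)))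
  (Q⇒free-at-i : ∀ π → IsInjective π → T (Q π) → lookup π i ∉ Fs) where

  #free #free∖j : ℕ
  #free   = length (free Fs)
  #free∖j = length (free (j ∷ Fs))

  QM : SelfMap n → Bool
  QM π = Q π ∧ maps i j π

  AQ : SelfMap n → Bool
  AQ π = avoids R π ∧ Q π

  A′QM : SelfMap n → Bool
  A′QM π = avoids (remove R i j) π ∧ QM π

  -- The position of the value j, or i if j is not a value of π.
  preimage : SelfMap n → Fin n
  preimage π with any? (λ k → lookup π k ≟ j)
  ... | yes (k , _) = k
  ... | no _        = i

  lookup-preimage : ∀ π {k} → lookup π k ≡ j → lookup π (preimage π) ≡ j
  lookup-preimage π {k} πk≡j with any? (λ k → lookup π k ≟ j)
  ... | yes (_ , πk′≡j) = πk′≡j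
  ... | no ∄k           = contradiction (k , πk≡j) ∄k

  preimage-≢ : ∀ π → preimage π ≢ i → lookup π (preimage π) ≡ j
  preimage-≢ π p≢i with any? (λ k → lookup π k ≟ j)
  ... | yes (_ , πk≡j) = πk≡j
  ... | no _           = contradiction refl p≢i

  blocked : SelfMap n → Bool
  blocked π = not ⌊ preimage π ≟ i ⌋ ∧ R (preimage π) (lookup π i)

  AQB : SelfMap n → Bool
  AQB π = AQ π ∧ blocked π

  T-blocked : ∀ {π} → T (blocked π) → preimage π ≢ i × R (preimage π) (lookup π i) ≡ true
  T-blocked t = let p≢i , Rpl = to T-∧ t in toWitnessFalse p≢i , to T-≡ Rpl

  unblocked⇒R≡false : ∀ π → blocked π ≡ false → preimage π ≢ i → R (preimage π) (lookup π i) ≡ false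
  unblocked⇒R≡false π b p≢i with preimage π ≟ i
  ... | yes p≡i = contradiction p≡i p≢i
  ... | no _    = b

  #free*QM≤Q : #free ℕ.* count QM ℕ.≤ count Q
  #free*QM≤Q = subst (ℕ._≤ count Q) (length-cartesianProduct (free Fs) (SymWhere n QM))
    (length-≤-injection move unique into injective)
    where
    move : Fin n × SelfMap n → SelfMap n
    move (a , π) = swap j a π
    unique : Unique (cartesianProduct (free Fs) (SymWhere n QM))
    unique = Unique.cartesianProduct⁺ (free-unique Fs) (SymWhere-unique n QM)
    into : ∀ {x} → x ∈ cartesianProduct (free Fs) (SymWhere n QM) → move x ∈ SymWhere n Q
    into {a , π} x∈ =
      let a∈ , π∈ = ∈-cartesianProduct⁻ (free Fs) (SymWhere n QM) x∈
          inj , QMπ = to ∈-SymWhere π∈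
      in from ∈-SymWhere (swap-injective j a π inj , Q-swap j a π j∉Fs (∈-free a∈) (proj₁ (to T-∧ QMπ)))
    move-at-i : ∀ {x} → x ∈ cartesianProduct (free Fs) (SymWhere n QM) → lookup (move x) i ≡ proj₁ x
    move-at-i {a , π} x∈ = begin
      lookup (swap j a π) i       ≡⟨ lookup-swap j a π i ⟩
      transpose j a (lookup π i)  ≡⟨ cong (transpose j a) πi≡j ⟩
      transpose j a j             ≡⟨ transpose-ˡ j a ⟩
      a                           ∎
      where
      open ≡-Reasoning
      πi≡j : lookup π i ≡ j
      πi≡j = to (T-maps i j π) (proj₂ (to T-∧ (proj₂ (to ∈-SymWhere (proj₂ (∈-cartesianProduct⁻ (free Fs) (SymWhere n QM) x∈))))))
    injective : ∀ {x y} → x ∈ cartesianProduct (free Fs) (SymWhere n QM) → y ∈ cartesianProduct (free Fs) (SymWhere n QM) →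
      move x ≡ move y → x ≡ y
    injective {a , π} {b , ρ} x∈ y∈ eq with refl ← trans (sym (move-at-i x∈)) (trans (cong (λ σ → lookup σ i) eq) (move-at-i y∈))
      = cong (a ,_) (swap-cancel j a eq)

  unblocked-swap-avoids : ∀ π → IsInjective π → T (avoids R π) → blocked π ≡ false →
    T (avoids (remove R i j) (swap (lookup π i) j π))
  unblocked-swap-avoids π inj avoid unblocked-π = from (T-avoids (remove R i j) (swap l j π)) λ x →
    subst (λ v → remove R i j x v ≡ false) (sym (lookup-swap l j π x)) (avoids-at x (x ≟ i) (lookup π x ≟ j))
    where
    l : Fin n
    l = lookup π i
    avoids-at : ∀ x → Dec (x ≡ i) → Dec (lookup π x ≡ j) → remove R i j x (transpose l j (lookup π x)) ≡ false
    avoids-at x (yes refl) _ = subst (λ v → remove R i j i v ≡ false) (sym (transpose-ˡ l j)) (remove-removed R i j)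
    avoids-at x (no x≢i) (yes πx≡j) = remove-false R i j (begin
      R x (transpose l j (lookup π x))  ≡⟨ cong (λ v → R x (transpose l j v)) πx≡j ⟩
      R x (transpose l j j)             ≡⟨ cong (R x) (transpose-ʳ l j) ⟩
      R x l                             ≡⟨ cong (λ k → R k l) x≡preimage ⟩
      R (preimage π) l                  ≡⟨ unblocked⇒R≡false π unblocked-π (λ p≡i → x≢i (trans x≡preimage p≡i)) ⟩
      false                             ∎)
      where
      open ≡-Reasoning
      x≡preimage : x ≡ preimage π
      x≡preimage = inj x (preimage π) (trans πx≡j (sym (lookup-preimage π πx≡j)))
    avoids-at x (no x≢i) (no πx≢j) = remove-false R i j (trans
      (cong (R x) (transpose-fixes (λ πx≡l → x≢i (inj x i πx≡l)) πx≢j)) (to (T-avoids R π) avoid x))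

  AQ≤n*A′QM+AQB : count AQ ℕ.≤ n ℕ.* count A′QM ℕ.+ count AQB
  AQ≤n*A′QM+AQB = begin
    count AQ                                               ≡⟨ length-filterᵇ-split AQ blocked (Sym n) ⟩
    count unblockedAQ ℕ.+ count AQB                        ≤⟨ ℕ.+-monoˡ-≤ (count AQB) unblocked≤ ⟩
    n ℕ.* count A′QM ℕ.+ count AQB                         ∎
    where
    open ℕ.≤-Reasoning
    unblockedAQ : SelfMap n → Bool
    unblockedAQ π = AQ π ∧ not (blocked π)
    move : SelfMap n → Fin n × SelfMap n
    move π = lookup π i , swap (lookup π i) j π
    into : ∀ {π} → π ∈ SymWhere n unblockedAQ → move π ∈ cartesianProduct (allFin n) (SymWhere n A′QM)
    into {π} π∈ = ∈-cartesianProduct⁺ (∈-allFin _) (from ∈-SymWhere (swap-injective l j π inj ,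
        from T-∧ (unblocked-swap-avoids π inj Aπ (to T-not-≡ unblockedπ) ,
                  from T-∧ (Q-swap l j π (Q⇒free-at-i π inj Qπ) j∉Fs Qπ , from (T-maps i j (swap l j π)) moved-at-i))))
      where
      l : Fin n
      l = lookup π i
      inj : IsInjective π
      inj = proj₁ (to ∈-SymWhere π∈)
      AQπ×unblockedπ : T (AQ π) × T (not (blocked π))
      AQπ×unblockedπ = to T-∧ (proj₂ (to ∈-SymWhere π∈))
      Aπ : T (avoids R π)
      Aπ = proj₁ (to T-∧ (proj₁ AQπ×unblockedπ))
      Qπ : T (Q π)
      Qπ = proj₂ (to T-∧ (proj₁ AQπ×unblockedπ))
      unblockedπ : T (not (blocked π))
      unblockedπ = proj₂ AQπ×unblockedπ
      moved-at-i : lookup (swap l j π) i ≡ j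
      moved-at-i = trans (lookup-swap l j π i) (transpose-ˡ l j)
    unblocked≤ : count unblockedAQ ℕ.≤ n ℕ.* count A′QM
    unblocked≤ = ℕ.≤-trans
      (length-≤-injection move (SymWhere-unique n unblockedAQ) into
        (λ {π} {ρ} _ _ eq → swap-cancel (lookup π i) j (trans (cong proj₂ eq) (cong (λ l → swap l j ρ) (sym (cong proj₁ eq))))))
      (ℕ.≤-reflexive (trans (length-cartesianProduct (allFin n) (SymWhere n A′QM))
                            (cong (ℕ._* count A′QM) (length-tabulate {n = n} id))))

  R-pairs : List (Fin n × Fin n)
  R-pairs = filterᵇ (λ p → R (proj₁ p) (proj₂ p)) (cartesianProduct (allFin n) (allFin n))

  -- σ a π has the value a at preimage π, so a and then π can be read back from move (a , π).
  #free∖j*AQB≤R*QM : #free∖j ℕ.* count AQB ℕ.≤ card R ℕ.* count QM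
  #free∖j*AQB≤R*QM = subst₂ ℕ._≤_ (length-cartesianProduct (free (j ∷ Fs)) (SymWhere n AQB))
                                (length-cartesianProduct R-pairs (SymWhere n QM))
    (length-≤-injection move unique into injective)
    where
    σ : Fin n → SelfMap n → SelfMap n
    σ a π = swap (lookup π i) a (swap (lookup π i) j π)
    move : Fin n × SelfMap n → (Fin n × Fin n) × SelfMap n
    move (a , π) = (preimage π , lookup π i) , σ a π
    unique : Unique (cartesianProduct (free (j ∷ Fs)) (SymWhere n AQB))
    unique = Unique.cartesianProduct⁺ (free-unique (j ∷ Fs)) (SymWhere-unique n AQB)
    module Member {a : Fin n} {π : SelfMap n} (x∈ : (a , π) ∈ cartesianProduct (free (j ∷ Fs)) (SymWhere n AQB)) where
      a∉ : a ∉ j ∷ Fs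
      a∉ = ∈-free (proj₁ (∈-cartesianProduct⁻ (free (j ∷ Fs)) (SymWhere n AQB) x∈))
      inj : IsInjective π
      inj = proj₁ (to ∈-SymWhere (proj₂ (∈-cartesianProduct⁻ (free (j ∷ Fs)) (SymWhere n AQB) x∈)))
      AQπ×blockedπ : T (AQ π) × T (blocked π)
      AQπ×blockedπ = to T-∧ (proj₂ (to ∈-SymWhere (proj₂ (∈-cartesianProduct⁻ (free (j ∷ Fs)) (SymWhere n AQB) x∈))))
      Qπ : T (Q π)
      Qπ = proj₂ (to T-∧ (proj₁ AQπ×blockedπ))
      l : Fin n
      l = lookup π i
      preimage≢i : preimage π ≢ i
      preimage≢i = proj₁ (T-blocked (proj₂ AQπ×blockedπ))
      π-preimage : lookup π (preimage π) ≡ j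
      π-preimage = preimage-≢ π preimage≢i
      l≢j : l ≢ j
      l≢j πi≡j = preimage≢i (inj (preimage π) i (trans π-preimage (sym πi≡j)))
      σ-at-i : lookup (σ a π) i ≡ j
      σ-at-i = begin
        lookup (σ a π) i                                     ≡⟨ lookup-swap l a (swap l j π) i ⟩
        transpose l a (lookup (swap l j π) i)                ≡⟨ cong (transpose l a) (lookup-swap l j π i) ⟩
        transpose l a (transpose l j l)                      ≡⟨ cong (transpose l a) (transpose-ˡ l j) ⟩
        transpose l a j                                      ≡⟨ transpose-fixes (l≢j ∘ sym) (λ j≡a → a∉ (here (sym j≡a))) ⟩
        j                                                    ∎
        where open ≡-Reasoning
      σ-at-preimage : lookup (σ a π) (preimage π) ≡ a
      σ-at-preimage = begin
        lookup (σ a π) (preimage π)                          ≡⟨ lookup-swap l a (swap l j π) (preimage π) ⟩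
        transpose l a (lookup (swap l j π) (preimage π))     ≡⟨ cong (transpose l a) (lookup-swap l j π (preimage π)) ⟩
        transpose l a (transpose l j (lookup π (preimage π))) ≡⟨ cong (λ v → transpose l a (transpose l j v)) π-preimage ⟩
        transpose l a (transpose l j j)                      ≡⟨ cong (transpose l a) (transpose-ʳ l j) ⟩
        transpose l a l                                      ≡⟨ transpose-ˡ l a ⟩
        a                                                    ∎
        where open ≡-Reasoning
    into : ∀ {x} → x ∈ cartesianProduct (free (j ∷ Fs)) (SymWhere n AQB) → move x ∈ cartesianProduct R-pairs (SymWhere n QM)
    into {a , π} x∈ = ∈-cartesianProduct⁺
      (∈-filter⁺ (T? ∘ λ p → R (proj₁ p) (proj₂ p)) (∈-cartesianProduct⁺ (∈-allFin _) (∈-allFin _))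
                 (from T-≡ (proj₂ (T-blocked (proj₂ AQπ×blockedπ)))))
      (from ∈-SymWhere (swap-injective l a (swap l j π) (swap-injective l j π inj) ,
                        from T-∧ (Q-swap l a (swap l j π) l∉Fs (λ a∈Fs → a∉ (there a∈Fs)) (Q-swap l j π l∉Fs j∉Fs Qπ) ,
                                  from (T-maps i j (σ a π)) σ-at-i)))
      where
      open Member x∈
      l∉Fs : l ∉ Fs
      l∉Fs = Q⇒free-at-i π inj Qπ
    injective : ∀ {x y} → x ∈ cartesianProduct (free (j ∷ Fs)) (SymWhere n AQB) → y ∈ cartesianProduct (free (j ∷ Fs)) (SymWhere n AQB) →
      move x ≡ move y → x ≡ y
    injective {a , π} {b , ρ} x∈ y∈ eq
      with refl ← trans (sym (Member.σ-at-preimage x∈))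
                        (trans (cong₂ lookup (cong proj₂ eq) (cong (proj₁ ∘ proj₁) eq)) (Member.σ-at-preimage y∈))
      = cong (a ,_) (swap-cancel l j (swap-cancel l a (trans (cong proj₂ eq)
                                                            (cong (λ l′ → swap l′ a (swap l′ j ρ)) (sym (cong (proj₂ ∘ proj₁) eq))))))
      where
      l : Fin n
      l = lookup π i

  A′QM≤QM : count A′QM ℕ.≤ count QM
  A′QM≤QM = length-filterᵇ-mono (λ π → proj₂ ∘ to (T-∧ {avoids (remove R i j) π})) (Sym n)

  conditioning : ∀ {p q} .{{_ : ℕ.NonZero #free∖j}} →
    p ℕ.* count Q ℕ.≤ q ℕ.* count AQ → 0 ℕ.< count AQ →
    2 ℕ.* q ℕ.* card R ℕ.+ p ℕ.* #free∖j ℕ.* n ℕ.≤ 2 ℕ.* p ℕ.* #free∖j ℕ.* #free →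
    0 ℕ.< count QM × p ℕ.* count QM ℕ.≤ 2 ℕ.* q ℕ.* count A′QM
  conditioning {p} {q} pQ≤qAQ 0<AQ threshold =
    conditioning-pos {n} {#free∖j} {card R} {count AQ} {count A′QM} {count AQB} {count QM} 0<AQ AQ≤n*A′QM+AQB #free∖j*AQB≤R*QM A′QM≤QM ,
    conditioning-arith {p} {q} {n} {#free} {#free∖j} {card R} {count Q} {count AQ} {count A′QM} {count AQB} {count QM}
      {{ℕ.m*n≢0 n #free∖j {{nonZeroIndex i}}}} #free*QM≤Q pQ≤qAQ AQ≤n*A′QM+AQB #free∖j*AQB≤R*QM threshold

positive-of-≤ : ∀ {p b c a} → 0 ℕ.< p → 0 ℕ.< b → p ℕ.* b ℕ.≤ c ℕ.* a → 0 ℕ.< a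
positive-of-≤ {suc p} {suc b} {c} {zero} _ _ pb≤c0 with () ← subst (suc p ℕ.* suc b ℕ.≤_) (ℕ.*-zeroʳ c) pb≤c0
positive-of-≤ {a = suc _} _ _ _ = ℕ.z<s

module Steps {n : ℕ} (R : Rel2 n) where

  #Sym #avoiding : ℕ
  #Sym      = count {n} (λ _ → true)
  #avoiding = count (avoids R)

  first-step : ∀ {m} → n ≡ 2 ℕ.+ m → 8 ℕ.* #Sym ℕ.* card R ℕ.≤ m ℕ.* n ℕ.* #avoiding → 0 ℕ.< #avoiding →
    (i j : Fin n) → 0 ℕ.< count (maps i j) ×
      #avoiding ℕ.* count (maps i j) ℕ.≤ 2 ℕ.* #Sym ℕ.* count (λ π → avoids (remove R i j) π ∧ maps i j π)
  first-step n≡2+m threshold 0<#avoiding i j =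
    conditioning {#avoiding} {#Sym} {{ℕ.>-nonZero 0<#free∖j}}
      (ℕ.≤-reflexive (trans (ℕ.*-comm #avoiding #Sym) (cong (#Sym ℕ.*_) (sym #AQ≡#avoiding))))
      (subst (0 ℕ.<_) (sym #AQ≡#avoiding) 0<#avoiding)
      (threshold-first {#Sym} {card R} {#avoiding} {D = #free} {#free∖j} n≡2+m threshold (length-free []) n≤#free∖j+1)
    where
    open Conditioning R (λ _ → true) [] i j (λ ()) (λ _ _ _ _ _ _ → _) (λ _ _ _ ())
    #AQ≡#avoiding : count AQ ≡ #avoiding
    #AQ≡#avoiding = ℕ.≤-antisym (length-filterᵇ-mono (λ π → proj₁ ∘ to (T-∧ {avoids R π})) (Sym n))
                                (length-filterᵇ-mono (λ π t → from T-∧ (t , _)) (Sym n))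
    n≤#free∖j+1 : n ℕ.≤ #free∖j ℕ.+ 1
    n≤#free∖j+1 = length-free (j ∷ [])
    0<#free∖j : 0 ℕ.< #free∖j
    0<#free∖j = ℕ.+-cancelʳ-≤ 1 1 #free∖j (ℕ.≤-trans (subst (2 ℕ.≤_) (sym n≡2+m) (ℕ.m≤m+n 2 _)) n≤#free∖j+1)

  second-step : ∀ {m} → n ≡ 3 ℕ.+ m → 32 ℕ.* #Sym ℕ.* card R ℕ.≤ m ℕ.* n ℕ.* #avoiding → 0 ℕ.< #avoiding →
    (i₁ j₁ i₂ j₂ : Fin n) → i₁ ≢ i₂ → j₁ ≢ j₂ → 0 ℕ.< count (λ π → maps i₁ j₁ π ∧ maps i₂ j₂ π) ×
      #avoiding ℕ.* count (λ π → maps i₁ j₁ π ∧ maps i₂ j₂ π) ℕ.≤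
        4 ℕ.* #Sym ℕ.* count (λ π → avoids (remove (remove R i₁ j₁) i₂ j₂) π ∧ (maps i₁ j₁ π ∧ maps i₂ j₂ π))
  second-step {m} n≡3+m threshold 0<#avoiding i₁ j₁ i₂ j₂ i₁≢i₂ j₁≢j₂ =
    map₂ (subst (λ c → #avoiding ℕ.* count QM ℕ.≤ c ℕ.* count A′QM) (sym (ℕ.*-assoc 2 2 #Sym)))
      (conditioning {#avoiding} {2 ℕ.* #Sym} {{ℕ.>-nonZero 0<#free∖j}}
         (proj₂ first) (positive-of-≤ {c = 2 ℕ.* #Sym} {count AQ} 0<#avoiding (proj₁ first) (proj₂ first))
         (threshold-second {#Sym} {card R} {card (remove R i₁ j₁)} {#avoiding} {D = #free} {#free∖j}
            n≡3+m threshold (length-free (j₁ ∷ [])) (length-free (j₂ ∷ j₁ ∷ [])) (card-remove R i₁ j₁)))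
    where
    first : 0 ℕ.< count (maps i₁ j₁) ×
      #avoiding ℕ.* count (maps i₁ j₁) ℕ.≤ 2 ℕ.* #Sym ℕ.* count (λ π → avoids (remove R i₁ j₁) π ∧ maps i₁ j₁ π)
    first = first-step (trans n≡3+m (ℕ.+-suc 2 m)) 8Nr≤[m+1]nα 0<#avoiding i₁ j₁
      where
      8Nr≤[m+1]nα : 8 ℕ.* #Sym ℕ.* card R ℕ.≤ suc m ℕ.* n ℕ.* #avoiding
      8Nr≤[m+1]nα = ℕ.≤-trans (ℕ.*-monoˡ-≤ (card R) (ℕ.*-monoˡ-≤ #Sym (ℕ.m≤m+n 8 24)))
        (ℕ.≤-trans threshold (ℕ.*-monoˡ-≤ #avoiding (ℕ.*-monoˡ-≤ n (ℕ.n≤1+n m))))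
    j₁-fixed : ∀ x y π → x ∉ j₁ ∷ [] → y ∉ j₁ ∷ [] → T (maps i₁ j₁ π) → T (maps i₁ j₁ (swap x y π))
    j₁-fixed x y π x∉ y∉ t = from (T-maps i₁ j₁ (swap x y π)) (begin
      lookup (swap x y π) i₁       ≡⟨ lookup-swap x y π i₁ ⟩
      transpose x y (lookup π i₁)  ≡⟨ cong (transpose x y) (to (T-maps i₁ j₁ π) t) ⟩
      transpose x y j₁             ≡⟨ transpose-fixes (λ j₁≡x → x∉ (here (sym j₁≡x))) (λ j₁≡y → y∉ (here (sym j₁≡y))) ⟩
      j₁                           ∎)
      where open ≡-Reasoning
    i₂-free : ∀ π → IsInjective π → T (maps i₁ j₁ π) → lookup π i₂ ∉ j₁ ∷ []
    i₂-free π inj t (here πi₂≡j₁) = i₁≢i₂ (inj i₁ i₂ (trans (to (T-maps i₁ j₁ π) t) (sym πi₂≡j₁)))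
    j₂-free : j₂ ∉ j₁ ∷ []
    j₂-free (here j₂≡j₁) = j₁≢j₂ (sym j₂≡j₁)
    open Conditioning (remove R i₁ j₁) (maps i₁ j₁) (j₁ ∷ []) i₂ j₂ j₂-free j₁-fixed i₂-free
    0<#free∖j : 0 ℕ.< #free∖j
    0<#free∖j = ℕ.+-cancelʳ-≤ 2 1 #free∖j (ℕ.≤-trans (subst (3 ℕ.≤_) (sym n≡3+m) (ℕ.m≤m+n 3 m)) (length-free (j₂ ∷ j₁ ∷ [])))

-- Clearing denominators

toℚᵘ-ℕ→ℚ : ∀ k → toℚᵘ (ℕ→ℚ k) ℚᵘ.≃ mkℚᵘ (+ k) 0
toℚᵘ-ℕ→ℚ k = ℚ.toℚᵘ-fromℚᵘ (mkℚᵘ (+ k) 0)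

ℕ→ℚ-+ : ∀ a b → ℕ→ℚ (a ℕ.+ b) ≡ ℕ→ℚ a + ℕ→ℚ b
ℕ→ℚ-+ a b = ℚ.toℚᵘ-injective (begin
  toℚᵘ (ℕ→ℚ (a ℕ.+ b))                ≈⟨ toℚᵘ-ℕ→ℚ (a ℕ.+ b) ⟩
  mkℚᵘ (+ (a ℕ.+ b)) 0                ≈⟨ *≡* (cong (ℤ._* + 1) (trans (ℤ.pos-+ a b)
                                           (sym (cong₂ ℤ._+_ (ℤ.*-identityʳ (+ a)) (ℤ.*-identityʳ (+ b)))))) ⟩
  mkℚᵘ (+ a) 0 ℚᵘ.+ mkℚᵘ (+ b) 0      ≈⟨ ℚᵘ.+-cong (toℚᵘ-ℕ→ℚ a) (toℚᵘ-ℕ→ℚ b) ⟨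
  toℚᵘ (ℕ→ℚ a) ℚᵘ.+ toℚᵘ (ℕ→ℚ b)     ≈⟨ ℚ.toℚᵘ-homo-+ (ℕ→ℚ a) (ℕ→ℚ b) ⟨
  toℚᵘ (ℕ→ℚ a + ℕ→ℚ b)                ∎)
  where open ℚᵘ.≃-Reasoning

ℕ→ℚ-* : ∀ a b → ℕ→ℚ (a ℕ.* b) ≡ ℕ→ℚ a * ℕ→ℚ b
ℕ→ℚ-* a b = ℚ.toℚᵘ-injective (begin
  toℚᵘ (ℕ→ℚ (a ℕ.* b))                ≈⟨ toℚᵘ-ℕ→ℚ (a ℕ.* b) ⟩
  mkℚᵘ (+ (a ℕ.* b)) 0                ≈⟨ *≡* (cong (ℤ._* + 1) (ℤ.pos-* a b)) ⟩
  mkℚᵘ (+ a) 0 ℚᵘ.* mkℚᵘ (+ b) 0      ≈⟨ ℚᵘ.*-cong (toℚᵘ-ℕ→ℚ a) (toℚᵘ-ℕ→ℚ b) ⟨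
  toℚᵘ (ℕ→ℚ a) ℚᵘ.* toℚᵘ (ℕ→ℚ b)     ≈⟨ ℚ.toℚᵘ-homo-* (ℕ→ℚ a) (ℕ→ℚ b) ⟨
  toℚᵘ (ℕ→ℚ a * ℕ→ℚ b)                ∎)
  where open ℚᵘ.≃-Reasoning

ℕ→ℚ-mono-≤ : ∀ {a b} → a ℕ.≤ b → ℕ→ℚ a ≤ ℕ→ℚ b
ℕ→ℚ-mono-≤ {a} {b} a≤b = ℚ.toℚᵘ-cancel-≤
  (ℚᵘ.≤-respʳ-≃ (ℚᵘ.≃-sym (toℚᵘ-ℕ→ℚ b)) (ℚᵘ.≤-respˡ-≃ (ℚᵘ.≃-sym (toℚᵘ-ℕ→ℚ a))
    (*≤* (ℤ.*-monoʳ-≤-nonNeg (+ 1) (ℤ.+≤+ a≤b)))))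

ℕ→ℚ-cancel-≤ : ∀ {a b} → ℕ→ℚ a ≤ ℕ→ℚ b → a ℕ.≤ b
ℕ→ℚ-cancel-≤ {a} {b} le
  with *≤* h ← ℚᵘ.≤-respʳ-≃ (toℚᵘ-ℕ→ℚ b) (ℚᵘ.≤-respˡ-≃ (toℚᵘ-ℕ→ℚ a) (ℚ.toℚᵘ-mono-≤ le))
  with ℤ.+≤+ a≤b ← subst₂ ℤ._≤_ (ℤ.*-identityʳ (+ a)) (ℤ.*-identityʳ (+ b)) h = a≤b

ℕ→ℚ-mono-< : ∀ {a b} → a ℕ.< b → ℕ→ℚ a < ℕ→ℚ b
ℕ→ℚ-mono-< {a} {b} a<b = ℚ.≰⇒> (λ b≤a → ℕ.<⇒≱ a<b (ℕ→ℚ-cancel-≤ {b} {a} b≤a))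

ℕ→ℚ-nonNeg : ∀ a → 0ℚ ≤ ℕ→ℚ a
ℕ→ℚ-nonNeg a = ℕ→ℚ-mono-≤ {0} {a} z≤n

ratio-* : ∀ a b → ratio a (suc b) * ℕ→ℚ (suc b) ≡ ℕ→ℚ a
ratio-* a b = ℚ.toℚᵘ-injective (begin
  toℚᵘ (ratio a (suc b) * ℕ→ℚ (suc b))          ≈⟨ ℚ.toℚᵘ-homo-* (ratio a (suc b)) (ℕ→ℚ (suc b)) ⟩
  toℚᵘ (ratio a (suc b)) ℚᵘ.* toℚᵘ (ℕ→ℚ (suc b)) ≈⟨ ℚᵘ.*-cong (ℚ.toℚᵘ-fromℚᵘ (mkℚᵘ (+ a) b)) (toℚᵘ-ℕ→ℚ (suc b)) ⟩
  mkℚᵘ (+ a) b ℚᵘ.* mkℚᵘ (+ suc b) 0            ≈⟨ *≡* (trans (ℤ.*-identityʳ _) (cong (λ c → + a ℤ.* + c) (sym (ℕ.*-identityʳ (suc b))))) ⟩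
  mkℚᵘ (+ a) 0                                  ≈⟨ toℚᵘ-ℕ→ℚ a ⟨
  toℚᵘ (ℕ→ℚ a)                                  ∎)
  where open ℚᵘ.≃-Reasoning

≤-ratio⁻ : ∀ {γ} a b → 0ℚ < γ → γ ≤ ratio a b → 0 ℕ.< b × γ * ℕ→ℚ b ≤ ℕ→ℚ a
≤-ratio⁻ a zero    0<γ γ≤0 = contradiction (ℚ.<-≤-trans 0<γ γ≤0) (ℚ.<-irrefl refl)
≤-ratio⁻ {γ} a (suc b) 0<γ γ≤ = ℕ.z<s , (begin
  γ * ℕ→ℚ (suc b)                ≤⟨ ℚ.*-monoʳ-≤-nonNeg (ℕ→ℚ (suc b)) {{ℚ.nonNegative (ℕ→ℚ-nonNeg (suc b))}} γ≤ ⟩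
  ratio a (suc b) * ℕ→ℚ (suc b)  ≡⟨ ratio-* a b ⟩
  ℕ→ℚ a                          ∎)
  where open ℚ.≤-Reasoning

≤-ratio⁺ : ∀ {x} a b → 0 ℕ.< b → x * ℕ→ℚ b ≤ ℕ→ℚ a → x ≤ ratio a b
≤-ratio⁺ {x} a (suc b) _ le = ℚ.*-cancelʳ-≤-pos (ℕ→ℚ (suc b)) {{ℚ.positive (ℕ→ℚ-mono-< {0} {suc b} ℕ.z<s)}}
  (subst (x * ℕ→ℚ (suc b) ≤_) (sym (ratio-* a b)) le)

÷-* : ∀ x y .{{_ : ℚ.NonZero y}} → (x ÷ y) * y ≡ x
÷-* x y = trans (ℚ.*-assoc x (1/ y) y) (trans (cong (x *_) (ℚ.*-inverseˡ y)) (ℚ.*-identityʳ x))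

+-cancelʳ-≤ : ∀ {x y z} → y + x ≤ z + x → y ≤ z
+-cancelʳ-≤ {x} {y} {z} le = subst₂ _≤_ (cancel y) (cancel z) (ℚ.+-monoˡ-≤ (- x) le)
  where
  open ℚ-Solver.+-*-Solver
  cancel : ∀ w → w + x + - x ≡ w
  cancel w = solve 2 (λ w x → w :+ x :+ :- x := w) refl w x

threshold⁻ : ∀ {x γ} k n .{{_ : ℚ.NonZero γ}} → 0ℚ < γ → 0ℚ ≤ x →
  x ÷ γ + ℕ→ℚ k ≤ ℕ→ℚ n → ∃[ m ] n ≡ k ℕ.+ m × x ≤ ℕ→ℚ m * γ
threshold⁻ {x} {γ} k n 0<γ 0≤x h = n ∸ k , n≡k+m , +-cancelʳ-≤ (begin
    x + ℕ→ℚ k * γ                   ≤⟨ scaled ⟩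
    ℕ→ℚ n * γ                       ≡⟨ cong (λ l → ℕ→ℚ l * γ) n≡k+m ⟩
    ℕ→ℚ (k ℕ.+ (n ∸ k)) * γ         ≡⟨ cong (_* γ) (ℕ→ℚ-+ k (n ∸ k)) ⟩
    (ℕ→ℚ k + ℕ→ℚ (n ∸ k)) * γ       ≡⟨ solve 3 (λ k m γ → (k :+ m) :* γ := m :* γ :+ k :* γ) refl (ℕ→ℚ k) (ℕ→ℚ (n ∸ k)) γ ⟩
    ℕ→ℚ (n ∸ k) * γ + ℕ→ℚ k * γ     ∎)
  where
  open ℚ.≤-Reasoning
  open ℚ-Solver.+-*-Solver
  scaled : x + ℕ→ℚ k * γ ≤ ℕ→ℚ n * γ
  scaled = begin
    x + ℕ→ℚ k * γ              ≡⟨ cong (_+ ℕ→ℚ k * γ) (÷-* x γ) ⟨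
    x ÷ γ * γ + ℕ→ℚ k * γ      ≡⟨ ℚ.*-distribʳ-+ γ (x ÷ γ) (ℕ→ℚ k) ⟨
    (x ÷ γ + ℕ→ℚ k) * γ        ≤⟨ ℚ.*-monoʳ-≤-nonNeg γ {{ℚ.nonNegative (ℚ.<⇒≤ 0<γ)}} h ⟩
    ℕ→ℚ n * γ                  ∎
  k≤n : k ℕ.≤ n
  k≤n = ℕ→ℚ-cancel-≤ (ℚ.*-cancelʳ-≤-pos γ {{ℚ.positive 0<γ}} (begin
    ℕ→ℚ k * γ                  ≡⟨ ℚ.+-identityˡ (ℕ→ℚ k * γ) ⟨
    0ℚ + ℕ→ℚ k * γ             ≤⟨ ℚ.+-monoˡ-≤ (ℕ→ℚ k * γ) 0≤x ⟩
    x + ℕ→ℚ k * γ              ≤⟨ scaled ⟩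
    ℕ→ℚ n * γ                  ∎))
  n≡k+m : n ≡ k ℕ.+ (n ∸ k)
  n≡k+m = sym (ℕ.m+[n∸m]≡n k≤n)

scaled-threshold : ∀ {C γ} c r n N α m → 0ℚ ≤ γ →
  ℕ→ℚ r ≤ C * ℕ→ℚ n → γ * ℕ→ℚ N ≤ ℕ→ℚ α → ℕ→ℚ c * C ≤ ℕ→ℚ m * γ →
  c ℕ.* N ℕ.* r ℕ.≤ m ℕ.* n ℕ.* α
scaled-threshold {C} {γ} c r n N α m 0≤γ r≤Cn γN≤α cC≤mγ = ℕ→ℚ-cancel-≤ (begin
  ℕ→ℚ (c ℕ.* N ℕ.* r)              ≡⟨ ℕ→ℚ-* (c ℕ.* N) r ⟩
  ℕ→ℚ (c ℕ.* N) * ℕ→ℚ r            ≤⟨ ℚ.*-monoˡ-≤-nonNeg (ℕ→ℚ (c ℕ.* N)) {{ℚ.nonNegative (ℕ→ℚ-nonNeg (c ℕ.* N))}} r≤Cn ⟩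
  ℕ→ℚ (c ℕ.* N) * (C * ℕ→ℚ n)      ≡⟨ cong (_* (C * ℕ→ℚ n)) (ℕ→ℚ-* c N) ⟩
  ℕ→ℚ c * ℕ→ℚ N * (C * ℕ→ℚ n)      ≡⟨ solve 4 (λ c N C n → c :* N :* (C :* n) := c :* C :* (n :* N)) refl (ℕ→ℚ c) (ℕ→ℚ N) C (ℕ→ℚ n) ⟩
  ℕ→ℚ c * C * (ℕ→ℚ n * ℕ→ℚ N)      ≤⟨ ℚ.*-monoʳ-≤-nonNeg (ℕ→ℚ n * ℕ→ℚ N) {{ℚ.nonNegative 0≤nN}} cC≤mγ ⟩
  ℕ→ℚ m * γ * (ℕ→ℚ n * ℕ→ℚ N)      ≡⟨ solve 4 (λ m γ n N → m :* γ :* (n :* N) := m :* n :* (γ :* N)) refl (ℕ→ℚ m) γ (ℕ→ℚ n) (ℕ→ℚ N) ⟩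
  ℕ→ℚ m * ℕ→ℚ n * (γ * ℕ→ℚ N)      ≤⟨ ℚ.*-monoˡ-≤-nonNeg (ℕ→ℚ m * ℕ→ℚ n) {{ℚ.nonNegative 0≤mn}} γN≤α ⟩
  ℕ→ℚ m * ℕ→ℚ n * ℕ→ℚ α            ≡⟨ cong (_* ℕ→ℚ α) (ℕ→ℚ-* m n) ⟨
  ℕ→ℚ (m ℕ.* n) * ℕ→ℚ α            ≡⟨ ℕ→ℚ-* (m ℕ.* n) α ⟨
  ℕ→ℚ (m ℕ.* n ℕ.* α)              ∎)
  where
  open ℚ.≤-Reasoning
  open ℚ-Solver.+-*-Solver
  0≤nN : 0ℚ ≤ ℕ→ℚ n * ℕ→ℚ N
  0≤nN = subst (0ℚ ≤_) (ℕ→ℚ-* n N) (ℕ→ℚ-nonNeg (n ℕ.* N))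
  0≤mn : 0ℚ ≤ ℕ→ℚ m * ℕ→ℚ n
  0≤mn = subst (0ℚ ≤_) (ℕ→ℚ-* m n) (ℕ→ℚ-nonNeg (m ℕ.* n))

ratio-lower-bound : ∀ {γ} k N α a b .{{_ : ℚ.NonZero (ℕ→ℚ k)}} → 0 ℕ.< N → γ * ℕ→ℚ N ≤ ℕ→ℚ α →
  0 ℕ.< b → α ℕ.* b ℕ.≤ k ℕ.* N ℕ.* a → γ ÷ ℕ→ℚ k ≤ ratio a b
ratio-lower-bound {γ} k N α a b 0<N γN≤α 0<b αb≤kNa = ≤-ratio⁺ a b 0<b
  (ℚ.*-cancelˡ-≤-pos (ℕ→ℚ k * ℕ→ℚ N) {{ℚ.pos*pos⇒pos (ℕ→ℚ k) (ℕ→ℚ N)}} (begin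
    ℕ→ℚ k * ℕ→ℚ N * (γ ÷ ℕ→ℚ k * ℕ→ℚ b) ≡⟨ solve 4 (λ k N x b → k :* N :* (x :* b) := x :* k :* (N :* b)) refl (ℕ→ℚ k) (ℕ→ℚ N) (γ ÷ ℕ→ℚ k) (ℕ→ℚ b) ⟩
    γ ÷ ℕ→ℚ k * ℕ→ℚ k * (ℕ→ℚ N * ℕ→ℚ b) ≡⟨ cong (_* (ℕ→ℚ N * ℕ→ℚ b)) (÷-* γ (ℕ→ℚ k)) ⟩
    γ * (ℕ→ℚ N * ℕ→ℚ b)                 ≡⟨ ℚ.*-assoc γ (ℕ→ℚ N) (ℕ→ℚ b) ⟨
    γ * ℕ→ℚ N * ℕ→ℚ b                   ≤⟨ ℚ.*-monoʳ-≤-nonNeg (ℕ→ℚ b) {{ℚ.nonNegative (ℕ→ℚ-nonNeg b)}} γN≤α ⟩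
    ℕ→ℚ α * ℕ→ℚ b                       ≡⟨ ℕ→ℚ-* α b ⟨
    ℕ→ℚ (α ℕ.* b)                       ≤⟨ ℕ→ℚ-mono-≤ αb≤kNa ⟩
    ℕ→ℚ (k ℕ.* N ℕ.* a)                 ≡⟨ trans (ℕ→ℚ-* (k ℕ.* N) a) (cong (_* ℕ→ℚ a) (ℕ→ℚ-* k N)) ⟩
    ℕ→ℚ k * ℕ→ℚ N * ℕ→ℚ a               ∎))
  where
  open ℚ.≤-Reasoning
  open ℚ-Solver.+-*-Solver
  instance
    k-positive : ℚ.Positive (ℕ→ℚ k)
    k-positive = ℚ.nonNeg∧nonZero⇒pos (ℕ→ℚ k) {{ℚ.nonNegative (ℕ→ℚ-nonNeg k)}}
    N-positive : ℚ.Positive (ℕ→ℚ N)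
    N-positive = ℚ.positive (ℕ→ℚ-mono-< {0} {N} 0<N)

cleared-positive : ∀ {γ} a b → 0ℚ < γ → 0 ℕ.< b → γ * ℕ→ℚ b ≤ ℕ→ℚ a → 0 ℕ.< a
cleared-positive {γ} zero b 0<γ 0<b γb≤0 = contradiction (ℚ.<-≤-trans 0<γb γb≤0) (ℚ.<-irrefl refl)
  where
  0<γb : 0ℚ < γ * ℕ→ℚ b
  0<γb = ℚ.positive⁻¹ (γ * ℕ→ℚ b)
    {{ℚ.pos*pos⇒pos γ {{ℚ.positive 0<γ}} (ℕ→ℚ b) {{ℚ.positive (ℕ→ℚ-mono-< {0} {b} 0<b)}}}}
cleared-positive (suc a) _ _ _ _ = ℕ.z<s

counting-threshold : ∀ {C γ} c k n r N α .{{_ : ℚ.NonZero γ}} → 0ℚ < C → 0ℚ < γ →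
  ℕ→ℚ r ≤ C * ℕ→ℚ n → γ * ℕ→ℚ N ≤ ℕ→ℚ α → ℕ→ℚ c * C ÷ γ + ℕ→ℚ k ≤ ℕ→ℚ n →
  ∃[ m ] n ≡ k ℕ.+ m × c ℕ.* N ℕ.* r ℕ.≤ m ℕ.* n ℕ.* α
counting-threshold {C} c k n r N α 0<C 0<γ r≤Cn γN≤α h =
  let m , n≡k+m , cC≤mγ = threshold⁻ k n 0<γ 0≤cC h
  in m , n≡k+m , scaled-threshold c r n N α m (ℚ.<⇒≤ 0<γ) r≤Cn γN≤α cC≤mγ
  where
  0≤cC : 0ℚ ≤ ℕ→ℚ c * C
  0≤cC = subst (_≤ ℕ→ℚ c * C) (ℚ.*-zeroʳ (ℕ→ℚ c))
    (ℚ.*-monoˡ-≤-nonNeg (ℕ→ℚ c) {{ℚ.nonNegative (ℕ→ℚ-nonNeg c)}} (ℚ.<⇒≤ 0<C))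

lemma2p5 : (n : ℕ) (R : Rel2 n) (C γ : ℚ) (C>0 : 0ℚ < C) (γ>0 : 0ℚ < γ)
    → ℕ→ℚ (card R) ≤ C * ℕ→ℚ n
    → γ ≤ Pr (avoids R)
    → ((_÷_ (ℕ→ℚ 8 * C) γ {{>-nonZero γ>0}}) + ℕ→ℚ 2 ≤ ℕ→ℚ n
        → (i j : Fin n)
        → (γ ÷ ℕ→ℚ 2) ≤ PrCond (avoids (remove R i j)) (maps i j))
    × ((_÷_ (ℕ→ℚ 32 * C) γ {{>-nonZero γ>0}}) + ℕ→ℚ 3 ≤ ℕ→ℚ n
        → (i₁ j₁ i₂ j₂ : Fin n) → i₁ ≢ i₂ → j₁ ≢ j₂
        → γ ÷ ℕ→ℚ 4 ≤ PrCond (avoids (remove (remove R i₁ j₁) i₂ j₂))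
                                     (λ π → maps i₁ j₁ π ∧ maps i₂ j₂ π))
lemma2p5 n R C γ C>0 γ>0 hr hγ =
  (λ h i j →
    let m , n≡2+m , threshold = counting-threshold 8 2 n (card R) #Sym #avoiding {{>-nonZero γ>0}} C>0 γ>0 hr γ#Sym≤#avoiding h
        0<b , bound = first-step n≡2+m threshold 0<#avoiding i j
    in ratio-lower-bound {γ} 2 #Sym #avoiding (count (λ π → avoids (remove R i j) π ∧ maps i j π)) (count (maps i j))
         0<#Sym γ#Sym≤#avoiding 0<b bound) ,
  (λ h i₁ j₁ i₂ j₂ i₁≢i₂ j₁≢j₂ →
    let m , n≡3+m , threshold = counting-threshold 32 3 n (card R) #Sym #avoiding {{>-nonZero γ>0}} C>0 γ>0 hr γ#Sym≤#avoiding h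
        0<b , bound = second-step n≡3+m threshold 0<#avoiding i₁ j₁ i₂ j₂ i₁≢i₂ j₁≢j₂
    in ratio-lower-bound {γ} 4 #Sym #avoiding
         (count (λ π → avoids (remove (remove R i₁ j₁) i₂ j₂) π ∧ (maps i₁ j₁ π ∧ maps i₂ j₂ π)))
         (count (λ π → maps i₁ j₁ π ∧ maps i₂ j₂ π))
         0<#Sym γ#Sym≤#avoiding 0<b bound)
  where
  open Steps R
  0<#Sym : 0 ℕ.< #Sym
  0<#Sym = proj₁ (≤-ratio⁻ #avoiding #Sym γ>0 hγ)
  γ#Sym≤#avoiding : γ * ℕ→ℚ #Sym ≤ ℕ→ℚ #avoiding
  γ#Sym≤#avoiding = proj₂ (≤-ratio⁻ #avoiding #Sym γ>0 hγ)
  0<#avoiding : 0 ℕ.< #avoiding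
  0<#avoiding = cleared-positive #avoiding #Sym γ>0 0<#Sym γ#Sym≤#avoiding
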